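{- Fix any positive integer $k$. For every sufficiently large prime $p$ (depending on $k$), there exists a $g$-difference set $A\subseteq(\mathbb{Z}/p\mathbb{Z})^2$ of size $|A|=k(p-1)+1$, where $$g=\left\lceil k^2-2(k-1)-2k^{3/2}\right\rceil \;\bigl(=k^2+O(k^{3/2})\bigr).$$
   Context: For a subset $A$ of an abelian group $G$, let $r_A(x)=|\{(a_1,a_2)\in A\times A: x=a_1-a_2\}|$. $A$ is a $g$-difference set (in $G$) if $r_A(x)\ge g$ for all $x\in G$. -}

module Defs where

open import Data.Nat using (ℕ; zero; suc; _+_; _*_; _∸_; _≤ᵇ_; NonZero)
open import Data.Nat.DivMod using (_mod_)
open import Data.Fin using (Fin; toℕ)
open import Data.Fin.Properties renaming (_≟_ to _≟F_)
open import Data.Product using (_×_; _,_)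
open import Data.Product.Properties using (≡-dec)
open import Data.List using (List; length; filter; cartesianProduct)
open import Data.Bool using (if_then_else_)
open import Data.Integer using (ℤ; +_; _-_; _≤_)
open import Relation.Binary.PropositionalEquality using (_≡_)
open import Relation.Nullary using (Dec)

ZpSq : ℕ → Set
ZpSq p = Fin p × Fin p

subF : ∀ {p} .{{_ : NonZero p}} → Fin p → Fin p → Fin p
subF {p} a b = (toℕ a + (p ∸ toℕ b)) mod p

subG : ∀ {p} .{{_ : NonZero p}} → ZpSq p → ZpSq p → ZpSq p
subG (a₁ , a₂) (b₁ , b₂) = subF a₁ b₁ , subF a₂ b₂

_≟G_ : ∀ {p} (x y : ZpSq p) → Dec (x ≡ y)
_≟G_ = ≡-dec _≟F_ _≟F_

-- r_A(x) = #{(a₁,a₂) ∈ A × A : x = a₁ - a₂}   (A given as a duplicate-free list)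
rep : ∀ {p} .{{_ : NonZero p}} → List (ZpSq p) → ZpSq p → ℕ
rep A x = length (filter (λ { (a₁ , a₂) → subG a₁ a₂ ≟G x }) (cartesianProduct A A))

IsDiffSet : ∀ {p} .{{_ : NonZero p}} → ℤ → List (ZpSq p) → Set
IsDiffSet {p} g A = (x : ZpSq p) → g ≤ + rep A x

isqrtGo : ℕ → ℕ → ℕ
isqrtGo n zero = zero
isqrtGo n (suc m) = if (suc m * suc m) ≤ᵇ n then suc m else isqrtGo n m

isqrt : ℕ → ℕ
isqrt n = isqrtGo n n

-- g(k) = ⌈k² − 2(k−1) − 2k^{3/2}⌉ = k² − 2k + 2 − ⌊√(4k³)⌋   (as an integer)
gOf : ℕ → ℤ
gOf k = (+ (k * k + 2) - + (2 * k)) - + isqrt (4 * (k * k * k))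

-- For 1 ≤ k < p with p prime let A ⊆ (ℤ/pℤ)² consist of the origin and the
-- nonzero points of the k lines  v = c·u  of slopes c = 0, …, k − 1, so that
-- |A| = k(p − 1) + 1.  A point x = (u , v) ≠ 0 lies on at most one of these
-- lines.  For every ordered pair i ≠ j of slopes whose lines miss x, the system
--   T − S = u ,  i·T − j·S = v
-- has the solution T = (v − j·u)/(i − j), S = T − u with T, S ≠ 0, so that
-- (T , i·T) − (S , j·S) = x is a representation by two points of A; distinct
-- pairs give distinct representations.  Hence r_A(x) ≥ (k − 1)(k − 2), and also
-- r_A(0) ≥ |A| ≥ (k − 1)(k − 2).  Finally g(k) ≤ (k − 1)(k − 2) because
-- ⌊√(4k³)⌋ ≥ k, so A is a g(k)-difference set for every prime p > k.
module Submission where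

open import Defs
open import Data.Nat using (ℕ; zero; suc; _+_; _*_; _∸_; _≤_; _<_; z≤n; s≤s; s≤s⁻¹; _≤ᵇ_; NonZero; ≢-nonZero) renaming (_≟_ to _≟ℕ_)
open import Data.Nat.Properties
open import Data.Nat.DivMod
open import Data.Nat.Primality using (Prime; prime⇒nonZero)
open import Data.Nat.Coprimality using (prime⇒coprime; coprime-Bézout)
open import Data.Nat.GCD using (module Bézout)
open import Data.Fin using (Fin; toℕ) renaming (zero to 0F; suc to sucF)
open import Data.Fin.Properties using (toℕ-injective; toℕ<n; toℕ-fromℕ<) renaming (suc-injective to sucF-injective; _≟_ to _≟F_)
open import Data.Product using (Σ; _×_; _,_; proj₁; proj₂)
open import Data.Product.Properties using (≡-dec)
open import Data.List using (List; []; _∷_; _++_; length; filter; map; cartesianProduct; downFrom; allFin)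
open import Data.List.Properties using (filter-all; filter-++; length-++; length-filter; length-map; length-downFrom; length-tabulate)
open import Data.List.Relation.Unary.All as All using (All; []; _∷_)
open import Data.List.Relation.Unary.Any using (here; there; any?)
open import Data.List.Relation.Unary.AllPairs using ([]; _∷_)
open import Data.List.Relation.Unary.Unique.Propositional using (Unique)
import Data.List.Relation.Unary.Unique.Propositional.Properties as Unique
open import Data.List.Membership.Propositional using (_∈_; find; lose)
open import Data.List.Membership.Propositional.Properties
open import Relation.Binary.PropositionalEquality
open import Relation.Binary.Definitions using (DecidableEquality)
open import Relation.Nullary using (¬_; Dec; yes; no; ¬?; contradiction)
open import Data.Empty using (⊥-elim)
open import Data.Bool using (true; false)
import Data.Bool as Bool
open import Data.Sum using (inj₁; inj₂)
import Data.Integer as ℤ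
import Data.Integer.Properties as ℤP
open import Level using (0ℓ)
open import Relation.Binary.Bundles using (Setoid)
import Relation.Binary.Reasoning.Setoid
import Relation.Nullary.Decidable as Decidable
open import Data.Nat.Solver using (module +-*-Solver)
open +-*-Solver using (solve; _:+_; _:*_; _:=_; con)

module Counting {A : Set} (_≟_ : DecidableEquality A) where

  remove : A → List A → List A
  remove x = filter (λ y → ¬? (x ≟ y))

  length-remove< : ∀ x ys → x ∈ ys → suc (length (remove x ys)) ≤ length ys
  length-remove< x (y ∷ ys) (here refl) with x ≟ x
  ... | yes _ = s≤s (length-filter (λ y → ¬? (x ≟ y)) ys)
  ... | no x≢x = contradiction refl x≢x
  length-remove< x (y ∷ ys) (there x∈ys) with x ≟ y
  ... | yes _ = s≤s (≤-trans (n≤1+n _) (length-remove< x ys x∈ys))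
  ... | no _ = s≤s (length-remove< x ys x∈ys)

  length-remove : ∀ x ys → Unique ys → x ∈ ys → suc (length (remove x ys)) ≡ length ys
  length-remove x (y ∷ ys) (y∉ys ∷ _) (here refl) with x ≟ x
  ... | yes _ = cong (λ zs → suc (length zs)) (filter-all (λ z → ¬? (x ≟ z)) y∉ys)
  ... | no x≢x = contradiction refl x≢x
  length-remove x (y ∷ ys) (y∉ys ∷ u) (there x∈ys) with x ≟ y
  ... | yes refl = ⊥-elim (All.lookup y∉ys x∈ys refl)
  ... | no _ = cong suc (length-remove x ys u x∈ys)

  unique-⊆⇒length-≤ : ∀ xs ys → Unique xs → (∀ {z} → z ∈ xs → z ∈ ys) → length xs ≤ length ys
  unique-⊆⇒length-≤ [] ys _ _ = z≤n
  unique-⊆⇒length-≤ (x ∷ xs) ys (x∉xs ∷ u) xs⊆ys =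
    ≤-trans (s≤s (unique-⊆⇒length-≤ xs (remove x ys) u xs⊆ys-x)) (length-remove< x ys (xs⊆ys (here refl)))
    where
    xs⊆ys-x : ∀ {z} → z ∈ xs → z ∈ remove x ys
    xs⊆ys-x z∈xs = ∈-filter⁺ (λ y → ¬? (x ≟ y)) (xs⊆ys (there z∈xs)) (All.lookup x∉xs z∈xs)

  distinct? : (ab : A × A) → Dec (¬ proj₁ ab ≡ proj₂ ab)
  distinct? (a , b) = ¬? (a ≟ b)

  offDiagonal : List A → List (A × A)
  offDiagonal xs = filter distinct? (cartesianProduct xs xs)

  length-offDiagonal : ∀ xs → Unique xs → length (offDiagonal xs) ≡ length xs * (length xs ∸ 1)
  length-offDiagonal xs u = rows xs (All.tabulate (λ x∈xs → x∈xs))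
    where
    row : ∀ x ys → length (filter distinct? (map (x ,_) ys)) ≡ length (remove x ys)
    row x [] = refl
    row x (y ∷ ys) with x ≟ y
    ... | yes _ = row x ys
    ... | no _ = cong suc (row x ys)

    rows : ∀ zs → All (_∈ xs) zs → length (filter distinct? (cartesianProduct zs xs)) ≡ length zs * (length xs ∸ 1)
    rows [] _ = refl
    rows (z ∷ zs) (z∈xs ∷ zs⊆xs) = begin
        length (filter distinct? (map (z ,_) xs ++ cartesianProduct zs xs))
          ≡⟨ cong length (filter-++ distinct? (map (z ,_) xs) (cartesianProduct zs xs)) ⟩
        length (filter distinct? (map (z ,_) xs) ++ filter distinct? (cartesianProduct zs xs))
          ≡⟨ length-++ (filter distinct? (map (z ,_) xs)) ⟩
        length (filter distinct? (map (z ,_) xs)) + length (filter distinct? (cartesianProduct zs xs))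
          ≡⟨ cong₂ _+_ (row z xs) (rows zs zs⊆xs) ⟩
        length (remove z xs) + length zs * (length xs ∸ 1)
          ≡⟨ cong (λ n → n ∸ 1 + length zs * (length xs ∸ 1)) (length-remove z xs u z∈xs) ⟩
        (length xs ∸ 1) + length zs * (length xs ∸ 1) ∎
      where open ≡-Reasoning

map-unique-on : {A B : Set} (P : A → Set) (f : A → B) →
  (∀ {x y} → P x → P y → f x ≡ f y → x ≡ y) →
  ∀ {xs} → All P xs → Unique xs → Unique (map f xs)
map-unique-on P f inj [] [] = []
map-unique-on P f inj (px ∷ pxs) (x∉xs ∷ u) = images-differ px pxs x∉xs ∷ map-unique-on P f inj pxs u
  where
  images-differ : ∀ {x ys} → P x → All P ys → All (λ y → ¬ x ≡ y) ys → All (λ y → ¬ f x ≡ y) (map f ys)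
  images-differ _ [] [] = []
  images-differ px (py ∷ pys) (x≢y ∷ x∉ys) = (λ fx≡fy → x≢y (inj px py fx≡fy)) ∷ images-differ px pys x∉ys

length-cartesianProduct : {X Y : Set} (xs : List X) (ys : List Y) →
  length (cartesianProduct xs ys) ≡ length xs * length ys
length-cartesianProduct [] ys = refl
length-cartesianProduct (x ∷ xs) ys =
  trans (length-++ (map (x ,_) ys)) (cong₂ _+_ (length-map (x ,_) ys) (length-cartesianProduct xs ys))

module Modular (q : ℕ) where

  p : ℕ
  p = suc q

  infix 4 _≈_
  record _≈_ (a b : ℕ) : Set where
    constructor mk
    field same-residue : a % p ≡ b % p
  open _≈_

  ≈-setoid : Setoid 0ℓ 0ℓ
  ≈-setoid = record
    { Carrier = ℕ
    ; _≈_ = _≈_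
    ; isEquivalence = record
      { refl = mk refl
      ; sym = λ (mk e) → mk (sym e)
      ; trans = λ (mk e) (mk f) → mk (trans e f)
      }
    }
  open Setoid ≈-setoid public using () renaming (refl to ≈-refl; sym to ≈-sym; trans to ≈-trans)
  module ≈-Reasoning = Relation.Binary.Reasoning.Setoid ≈-setoid

  ≡⇒≈ : ∀ {a b} → a ≡ b → a ≈ b
  ≡⇒≈ e = mk (cong (_% p) e)

  _≈?_ : ∀ a b → Dec (a ≈ b)
  a ≈? b = Decidable.map′ mk same-residue (a % p ≟ℕ b % p)

  +-cong : ∀ {a b c d} → a ≈ b → c ≈ d → a + c ≈ b + d
  +-cong {a} {b} {c} {d} (mk a≡b) (mk c≡d) = mk (begin
    (a + c) % p          ≡⟨ %-distribˡ-+ a c p ⟩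
    (a % p + c % p) % p  ≡⟨ cong₂ (λ x y → (x + y) % p) a≡b c≡d ⟩
    (b % p + d % p) % p  ≡⟨ %-distribˡ-+ b d p ⟨
    (b + d) % p          ∎)
    where open ≡-Reasoning

  *-cong : ∀ {a b c d} → a ≈ b → c ≈ d → a * c ≈ b * d
  *-cong {a} {b} {c} {d} (mk a≡b) (mk c≡d) = mk (begin
    (a * c) % p              ≡⟨ %-distribˡ-* a c p ⟩
    (a % p * (c % p)) % p    ≡⟨ cong₂ (λ x y → (x * y) % p) a≡b c≡d ⟩
    (b % p * (d % p)) % p    ≡⟨ %-distribˡ-* b d p ⟨
    (b * d) % p              ∎)
    where open ≡-Reasoning

  %-≈ : ∀ a → a % p ≈ a
  %-≈ a = mk (m%n%n≡m%n a p)

  *p≈0 : ∀ a → a * p ≈ 0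
  *p≈0 a = mk (m*n%n≡0 a p)

  residue-≡ : ∀ {a b} → a < p → b < p → a ≈ b → a ≡ b
  residue-≡ {a} {b} a<p b<p (mk e) = trans (sym (m<n⇒m%n≡m a<p)) (trans e (m<n⇒m%n≡m b<p))

  neg : ℕ → ℕ
  neg a = p ∸ a % p

  neg-inverse : ∀ a → neg a + a ≈ 0
  neg-inverse a = begin
    neg a + a      ≈⟨ +-cong (≈-refl {neg a}) (≈-sym (%-≈ a)) ⟩
    neg a + a % p  ≡⟨ m∸n+n≡m (m%n≤n a p) ⟩
    p              ≈⟨ mk (n%n≡0 p) ⟩
    0              ∎
    where open ≈-Reasoning

  neg-*-inverse : ∀ a b → neg a * b + a * b ≈ 0
  neg-*-inverse a b = begin
    neg a * b + a * b  ≡⟨ *-distribʳ-+ b (neg a) a ⟨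
    (neg a + a) * b    ≈⟨ *-cong (neg-inverse a) (≈-refl {b}) ⟩
    0                  ∎
    where open ≈-Reasoning

  +-cancelʳ : ∀ {a b} c → a + c ≈ b + c → a ≈ b
  +-cancelʳ {a} {b} c a+c≈b+c = begin
    a                  ≡⟨ +-identityʳ a ⟨
    a + 0              ≈⟨ +-cong (≈-refl {a}) (≈-sym (neg-inverse c)) ⟩
    a + (neg c + c)    ≡⟨ shift a ⟩
    (a + c) + neg c    ≈⟨ +-cong a+c≈b+c (≈-refl {neg c}) ⟩
    (b + c) + neg c    ≡⟨ shift b ⟨
    b + (neg c + c)    ≈⟨ +-cong (≈-refl {b}) (neg-inverse c) ⟩
    b + 0              ≡⟨ +-identityʳ b ⟩
    b                  ∎
    where
    open ≈-Reasoning
    shift : ∀ x → x + (neg c + c) ≡ (x + c) + neg c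
    shift x = trans (cong (x +_) (+-comm (neg c) c)) (sym (+-assoc x c (neg c)))

  module Field (p-prime : Prime p) where

    inverse : ∀ a → ¬ a ≈ 0 → Σ ℕ (λ b → a * b ≈ 1)
    inverse a a≉0 = from-Bézout (coprime-Bézout (prime⇒coprime p-prime (m%n<n a p)))
      where
      instance
        r-nonZero : NonZero (a % p)
        r-nonZero = ≢-nonZero (λ e → a≉0 (mk e))
      r : ℕ
      r = a % p
      -- Bézout: 1 + y·r ≡ x·p  or  1 + x·p ≡ y·r.
      from-Bézout : Bézout.Identity 1 p r → Σ ℕ (λ b → a * b ≈ 1)
      from-Bézout (Bézout.-+ x y eq) = y , (begin
        a * y          ≈⟨ *-cong (≈-sym (%-≈ a)) (≈-refl {y}) ⟩
        r * y          ≡⟨ *-comm r y ⟩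
        y * r          ≡⟨ eq ⟨
        1 + x * p      ≈⟨ +-cong (≈-refl {1}) (*p≈0 x) ⟩
        1              ∎)
        where open ≈-Reasoning
      from-Bézout (Bézout.+- x y eq) = y * q , +-cancelʳ (r * y) (begin
        a * (y * q) + r * y  ≈⟨ +-cong (*-cong (≈-sym (%-≈ a)) (≈-refl {y * q})) (≈-refl {r * y}) ⟩
        r * (y * q) + r * y  ≡⟨ solve 3 (λ r y q → r :* (y :* q) :+ r :* y := (r :* y) :* (con 1 :+ q)) refl r y q ⟩
        (r * y) * p          ≈⟨ *p≈0 (r * y) ⟩
        0                    ≈⟨ *p≈0 x ⟨
        x * p                ≡⟨ eq ⟨
        1 + y * r            ≡⟨ cong (1 +_) (*-comm y r) ⟩
        1 + r * y            ∎)
        where open ≈-Reasoning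

    *-cancelʳ : ∀ {a b} c → ¬ c ≈ 0 → a * c ≈ b * c → a ≈ b
    *-cancelʳ {a} {b} c c≉0 ac≈bc with inverse c c≉0
    ... | c⁻¹ , cc⁻¹≈1 = begin
      a                ≡⟨ *-identityʳ a ⟨
      a * 1            ≈⟨ *-cong (≈-refl {a}) (≈-sym cc⁻¹≈1) ⟩
      a * (c * c⁻¹)    ≡⟨ *-assoc a c c⁻¹ ⟨
      a * c * c⁻¹      ≈⟨ *-cong ac≈bc (≈-refl {c⁻¹}) ⟩
      b * c * c⁻¹      ≡⟨ *-assoc b c c⁻¹ ⟩
      b * (c * c⁻¹)    ≈⟨ *-cong (≈-refl {b}) cc⁻¹≈1 ⟩
      b * 1            ≡⟨ *-identityʳ b ⟩
      b                ∎
      where open ≈-Reasoning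

    _⁻¹ : ℕ → ℕ
    a ⁻¹ with a ≈? 0
    ... | yes _ = 0
    ... | no a≉0 = proj₁ (inverse a a≉0)

    ⁻¹-inverse : ∀ a → ¬ a ≈ 0 → a * a ⁻¹ ≈ 1
    ⁻¹-inverse a a≉0 with a ≈? 0
    ... | yes a≈0 = contradiction a≈0 a≉0
    ... | no a≉0 = proj₂ (inverse a a≉0)

module Residues (q : ℕ) where
  open Modular q

  residue : ℕ → Fin p
  residue n = n mod p

  residue-≈ : ∀ n → toℕ (residue n) ≈ n
  residue-≈ n = ≈-trans (≡⇒≈ (toℕ-fromℕ< (m%n<n n p))) (%-≈ n)

  ≈⇒≡ : ∀ {a b : Fin p} → toℕ a ≈ toℕ b → a ≡ b
  ≈⇒≡ {a} {b} a≈b = toℕ-injective (residue-≡ (toℕ<n a) (toℕ<n b) a≈b)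

  nonzero : ∀ {t : Fin p} → ¬ t ≡ 0F → ¬ toℕ t ≈ 0
  nonzero t≢0 t≈0 = t≢0 (≈⇒≡ t≈0)

  subF-spec : ∀ (a b : Fin p) → toℕ (subF a b) + toℕ b ≈ toℕ a
  subF-spec a b = begin
    toℕ (subF a b) + toℕ b            ≈⟨ +-cong (residue-≈ (toℕ a + (p ∸ toℕ b))) (≈-refl {toℕ b}) ⟩
    toℕ a + (p ∸ toℕ b) + toℕ b       ≡⟨ +-assoc (toℕ a) (p ∸ toℕ b) (toℕ b) ⟩
    toℕ a + (p ∸ toℕ b + toℕ b)       ≡⟨ cong (toℕ a +_) (m∸n+n≡m (<⇒≤ (toℕ<n b))) ⟩
    toℕ a + p                         ≈⟨ mk ([m+n]%n≡m%n (toℕ a) p) ⟩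
    toℕ a                             ∎
    where open ≈-Reasoning

  subF-unique : ∀ (a b c : Fin p) → toℕ a ≈ toℕ c + toℕ b → subF a b ≡ c
  subF-unique a b c a≈c+b = ≈⇒≡ (+-cancelʳ (toℕ b) (≈-trans (subF-spec a b) a≈c+b))

rep-lower-bound : ∀ {p} .{{_ : NonZero p}} (B : List (ZpSq p)) (x : ZpSq p) (W : List (ZpSq p × ZpSq p)) →
  Unique W → (∀ {a₁ a₂} → (a₁ , a₂) ∈ W → a₁ ∈ B × a₂ ∈ B × subG a₁ a₂ ≡ x) → length W ≤ rep B x
rep-lower-bound B x W W-unique W-represents =
  unique-⊆⇒length-≤ W _ W-unique λ {(a₁ , a₂)} a∈W →
    let (a₁∈B , a₂∈B , a₁-a₂≡x) = W-represents a∈W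
    in ∈-filter⁺ _ (∈-cartesianProduct⁺ a₁∈B a₂∈B) a₁-a₂≡x
  where open Counting (≡-dec _≟G_ _≟G_)

module Construction (q k : ℕ) (p-prime : Prime (suc q)) (k<p : k < suc q) where
  open Modular q
  open Field p-prime
  open Residues q

  origin : ZpSq p
  origin = 0F , 0F

  point : ℕ → Fin p → ZpSq p
  point c t = t , residue (c * toℕ t)

  OnLine : ℕ → ZpSq p → Set
  OnLine c (u , v) = toℕ v ≈ c * toℕ u

  onLine? : ∀ c x → Dec (OnLine c x)
  onLine? c (u , v) = toℕ v ≈? (c * toℕ u)

  slope-unique : ∀ {c c'} x → ¬ x ≡ origin → c < p → c' < p → OnLine c x → OnLine c' x → c ≡ c'
  slope-unique {c} {c'} (u , v) x≢0 c<p c'<p v≈cu v≈c'u with u ≟F 0F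
  ... | yes refl = ⊥-elim (x≢0 (cong (0F ,_) (≈⇒≡ (≈-trans v≈cu (≡⇒≈ (*-zeroʳ c))))))
  ... | no u≢0 = residue-≡ c<p c'<p (*-cancelʳ (toℕ u) (nonzero u≢0) (≈-trans (≈-sym v≈cu) v≈c'u))

  point-injective : ∀ {c c' t t'} → c < p → c' < p → ¬ t ≡ 0F → point c t ≡ point c' t' → c ≡ c'
  point-injective {c} {c'} {t} {t'} c<p c'<p t≢0 same =
    slope-unique (point c t) (λ e → t≢0 (cong proj₁ e)) c<p c'<p
      (residue-≈ (c * toℕ t)) (subst (OnLine c') (sym same) (residue-≈ (c' * toℕ t')))

  -- The nonzero points of the lines, parametrised by slope c < k and t ∈ {1, …, p − 1}.
  parameters : List (ℕ × Fin q)
  parameters = cartesianProduct (downFrom k) (allFin q)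

  linePoint : ℕ × Fin q → ZpSq p
  linePoint (c , t) = point c (sucF t)

  A : List (ZpSq p)
  A = origin ∷ map linePoint parameters

  length-A : length A ≡ k * (p ∸ 1) + 1
  length-A = begin
    suc (length (map linePoint parameters))        ≡⟨ cong suc (length-map linePoint parameters) ⟩
    suc (length parameters)                        ≡⟨ cong suc (length-cartesianProduct (downFrom k) (allFin q)) ⟩
    suc (length (downFrom k) * length (allFin q))  ≡⟨ cong₂ (λ m n → suc (m * n)) (length-downFrom k) length-allFin ⟩
    suc (k * q)                                    ≡⟨ +-comm 1 (k * q) ⟩
    k * q + 1                                      ∎
    where
    open ≡-Reasoning
    length-allFin : length (allFin q) ≡ q
    length-allFin = length-tabulate (λ t → t)

  -- The listed points are pairwise distinct: the slope and t are read off a line point.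
  unique-A : Unique A
  unique-A = origin∉lines ∷ map-unique-on (λ (c , _) → c < p) linePoint linePoint-injective slopes<p
               (Unique.cartesianProduct⁺ (Unique.downFrom⁺ k) (Unique.allFin⁺ q))
    where
    origin∉lines : All (λ y → ¬ origin ≡ y) (map linePoint parameters)
    origin∉lines = All.tabulate λ y∈lines → off-origin (∈-map⁻ linePoint y∈lines)
      where
      off-origin : ∀ {y} → Σ (ℕ × Fin q) (λ ct → ct ∈ parameters × y ≡ linePoint ct) → ¬ origin ≡ y
      off-origin (_ , _ , refl) ()
    slopes<p : All (λ (c , _) → c < p) parameters
    slopes<p = All.tabulate λ c,t∈ → <-trans (∈-downFrom⁻ (proj₁ (∈-cartesianProduct⁻ (downFrom k) (allFin q) c,t∈))) k<p
    linePoint-injective : ∀ {x y} → proj₁ x < p → proj₁ y < p → linePoint x ≡ linePoint y → x ≡ y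
    linePoint-injective c<p c'<p same =
      cong₂ _,_ (point-injective c<p c'<p (λ ()) same) (sucF-injective (cong proj₁ same))

  point-∈-A : ∀ {c t} → c < k → ¬ t ≡ 0F → point c t ∈ A
  point-∈-A {t = 0F} c<k t≢0 = contradiction refl t≢0
  point-∈-A {t = sucF t} c<k t≢0 = there (∈-map⁺ linePoint (∈-cartesianProduct⁺ (∈-downFrom⁺ c<k) (∈-allFin t)))

  module Representation (u v : Fin p) where
    U V : ℕ
    U = toℕ u
    V = toℕ v

    record Admissible (ij : ℕ × ℕ) : Set where
      field
        i<k : proj₁ ij < k
        j<k : proj₂ ij < k
        i≢j : ¬ proj₁ ij ≡ proj₂ ij
        x∉Lᵢ : ¬ OnLine (proj₁ ij) (u , v)
        x∉Lⱼ : ¬ OnLine (proj₂ ij) (u , v)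

    -- The solution of  T − S = u,  i·T − j·S = v,  namely  T = (v − j·u)/(i − j),  S = T − u.
    T : ℕ → ℕ → Fin p
    T i j = residue ((i + neg j) ⁻¹ * (V + neg j * U))
    S : ℕ → ℕ → Fin p
    S i j = subF (T i j) u

    representation : ℕ × ℕ → ZpSq p × ZpSq p
    representation (i , j) = point i (T i j) , point j (S i j)

    module _ {i j : ℕ} (adm : Admissible (i , j)) where
      open Admissible adm
      open ≈-Reasoning

      i-j≉0 : ¬ i + neg j ≈ 0
      i-j≉0 i-j≈0 = i≢j (residue-≡ (<-trans i<k k<p) (<-trans j<k k<p) (+-cancelʳ (neg j) (begin
        i + neg j  ≈⟨ i-j≈0 ⟩
        0          ≈⟨ neg-inverse j ⟨
        neg j + j  ≡⟨ +-comm (neg j) j ⟩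
        j + neg j  ∎)))

      T-solves : (i + neg j) * toℕ (T i j) ≈ V + neg j * U
      T-solves = begin
        d * toℕ (T i j)  ≈⟨ *-cong (≈-refl {d}) (residue-≈ (d ⁻¹ * w)) ⟩
        d * (d ⁻¹ * w)   ≡⟨ *-assoc d (d ⁻¹) w ⟨
        d * d ⁻¹ * w     ≈⟨ *-cong (⁻¹-inverse d i-j≉0) (≈-refl {w}) ⟩
        1 * w            ≡⟨ *-identityˡ w ⟩
        w                ∎
        where
        d w : ℕ
        d = i + neg j
        w = V + neg j * U

      S+u≈T : toℕ (S i j) + U ≈ toℕ (T i j)
      S+u≈T = subF-spec (T i j) u

      -- T = 0 would put x on the line of slope j.
      T≢0 : ¬ T i j ≡ 0F
      T≢0 T≡0 = x∉Lⱼ (+-cancelʳ (neg j * U) (begin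
        V + neg j * U          ≈⟨ T-solves ⟨
        (i + neg j) * toℕ (T i j) ≡⟨ cong (λ t → (i + neg j) * toℕ t) T≡0 ⟩
        (i + neg j) * 0        ≡⟨ *-zeroʳ (i + neg j) ⟩
        0                      ≈⟨ neg-*-inverse j U ⟨
        neg j * U + j * U      ≡⟨ +-comm (neg j * U) (j * U) ⟩
        j * U + neg j * U      ∎))

      -- S = 0 would give T = u and put x on the line of slope i.
      S≢0 : ¬ S i j ≡ 0F
      S≢0 S≡0 = x∉Lᵢ (≈-sym (+-cancelʳ (neg j * U) (begin
        i * U + neg j * U          ≡⟨ *-distribʳ-+ U i (neg j) ⟨
        (i + neg j) * U            ≈⟨ *-cong (≈-refl {i + neg j}) T≈u ⟨
        (i + neg j) * toℕ (T i j)  ≈⟨ T-solves ⟩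
        V + neg j * U              ∎)))
        where
        T≈u : toℕ (T i j) ≈ U
        T≈u = ≈-trans (≈-sym S+u≈T) (≡⇒≈ (cong (λ s → toℕ s + U) S≡0))

      slope-equation : i * toℕ (T i j) ≈ V + j * toℕ (S i j)
      slope-equation = +-cancelʳ (neg j * Tₙ) (begin
        i * Tₙ + neg j * Tₙ              ≡⟨ *-distribʳ-+ Tₙ i (neg j) ⟨
        (i + neg j) * Tₙ                 ≈⟨ T-solves ⟩
        V + neg j * U                    ≈⟨ +-cong (≈-refl {V}) (+-cong (neg-*-inverse j Sₙ) (≈-refl {neg j * U})) ⟨
        V + ((neg j * Sₙ + j * Sₙ) + neg j * U)
          ≡⟨ solve 5 (λ V n j S U → V :+ ((n :* S :+ j :* S) :+ n :* U) := (V :+ j :* S) :+ n :* (S :+ U)) refl V (neg j) j Sₙ U ⟩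
        (V + j * Sₙ) + neg j * (Sₙ + U)  ≈⟨ +-cong (≈-refl {V + j * Sₙ}) (*-cong (≈-refl {neg j}) S+u≈T) ⟩
        (V + j * Sₙ) + neg j * Tₙ        ∎)
        where
        Tₙ Sₙ : ℕ
        Tₙ = toℕ (T i j)
        Sₙ = toℕ (S i j)

      represents : subG (point i (T i j)) (point j (S i j)) ≡ (u , v)
      represents = cong₂ _,_
        (subF-unique (T i j) (S i j) u (≈-trans (≈-sym S+u≈T) (≡⇒≈ (+-comm (toℕ (S i j)) U))))
        (subF-unique (residue (i * toℕ (T i j))) (residue (j * toℕ (S i j))) v (begin
          toℕ (residue (i * toℕ (T i j)))   ≈⟨ residue-≈ (i * toℕ (T i j)) ⟩
          i * toℕ (T i j)                   ≈⟨ slope-equation ⟩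
          V + j * toℕ (S i j)               ≈⟨ +-cong (≈-refl {V}) (residue-≈ (j * toℕ (S i j))) ⟨
          V + toℕ (residue (j * toℕ (S i j))) ∎))

    open Counting _≟ℕ_ using (offDiagonal; distinct?; length-offDiagonal)

    missing : List ℕ
    missing = filter (λ c → ¬? (onLine? c (u , v))) (downFrom k)

    pairs : List (ℕ × ℕ)
    pairs = offDiagonal missing

    pairs-admissible : All Admissible pairs
    pairs-admissible = All.tabulate λ {(i , j)} ij∈pairs →
      let (ij∈missing² , i≢j) = ∈-filter⁻ distinct? ij∈pairs
          (i∈missing , j∈missing) = ∈-cartesianProduct⁻ missing missing ij∈missing²
          (i∈k , x∉Lᵢ) = ∈-filter⁻ (λ c → ¬? (onLine? c (u , v))) i∈missing
          (j∈k , x∉Lⱼ) = ∈-filter⁻ (λ c → ¬? (onLine? c (u , v))) j∈missing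
      in record { i<k = ∈-downFrom⁻ i∈k ; j<k = ∈-downFrom⁻ j∈k ; i≢j = i≢j ; x∉Lᵢ = x∉Lᵢ ; x∉Lⱼ = x∉Lⱼ }

    -- Distinct admissible pairs give distinct representations (the slope is read off the point).
    representation-injective : ∀ {ij i'j'} → Admissible ij → Admissible i'j' →
      representation ij ≡ representation i'j' → ij ≡ i'j'
    representation-injective adm adm' same = cong₂ _,_
      (point-injective (<-trans (i<k adm) k<p) (<-trans (i<k adm') k<p) (T≢0 adm) (cong proj₁ same))
      (point-injective (<-trans (j<k adm) k<p) (<-trans (j<k adm') k<p) (S≢0 adm) (cong proj₂ same))
      where open Admissible

    missing-pairs-≤-rep : length missing * (length missing ∸ 1) ≤ rep A (u , v)
    missing-pairs-≤-rep = begin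
      length missing * (length missing ∸ 1)  ≡⟨ length-offDiagonal missing missing-unique ⟨
      length pairs                           ≡⟨ length-map representation pairs ⟨
      length (map representation pairs)      ≤⟨ rep-lower-bound A (u , v) _ representations-unique in-A ⟩
      rep A (u , v)                          ∎
      where
      open ≤-Reasoning
      missing-unique : Unique missing
      missing-unique = Unique.filter⁺ _ (Unique.downFrom⁺ k)
      representations-unique : Unique (map representation pairs)
      representations-unique = map-unique-on Admissible representation representation-injective pairs-admissible
        (Unique.filter⁺ distinct? (Unique.cartesianProduct⁺ missing-unique missing-unique))
      in-A : ∀ {a₁ a₂} → (a₁ , a₂) ∈ map representation pairs → a₁ ∈ A × a₂ ∈ A × subG a₁ a₂ ≡ (u , v)
      in-A a∈W with ∈-map⁻ representation a∈W
      ... | (i , j) , ij∈pairs , refl =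
        point-∈-A i<k (T≢0 adm) , point-∈-A j<k (S≢0 adm) , represents adm
        where
        adm : Admissible (i , j)
        adm = All.lookup pairs-admissible ij∈pairs
        open Admissible adm

  -- A point x ≠ 0 lies on at most one of the k lines, so at least k − 1 of them miss x.
  k≤1+missing : ∀ u v → ¬ (u , v) ≡ origin → k ≤ suc (length (Representation.missing u v))
  k≤1+missing u v x≢0 = subst (_≤ suc (length missing)) (length-downFrom k)
    (unique-⊆⇒length-≤ (downFrom k) (m ∷ missing) (Unique.downFrom⁺ k) slopes⊆m∷missing)
    where
    open Representation u v using (missing)
    open Counting _≟ℕ_ using (unique-⊆⇒length-≤)

    -- A slope shared by every line through x (when no line passes through x, any slope will do).
    common-slope : Σ ℕ (λ m → ∀ c → c < k → OnLine c (u , v) → c ≡ m)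
    common-slope with any? (λ c → onLine? c (u , v)) (downFrom k)
    ... | yes some = let (m , m∈k , x∈Lₘ) = find some in
      m , λ c c<k x∈L → slope-unique (u , v) x≢0 (<-trans c<k k<p) (<-trans (∈-downFrom⁻ m∈k) k<p) x∈L x∈Lₘ
    ... | no none = 0 , λ c c<k x∈L → contradiction (lose (∈-downFrom⁺ c<k) x∈L) none

    m : ℕ
    m = proj₁ common-slope

    slopes⊆m∷missing : ∀ {c} → c ∈ downFrom k → c ∈ m ∷ missing
    slopes⊆m∷missing {c} c∈k with onLine? c (u , v)
    ... | yes x∈L = here (proj₂ common-slope c (∈-downFrom⁻ c∈k) x∈L)
    ... | no x∉L = there (∈-filter⁺ _ c∈k x∉L)

  -- The diagonal pairs (a , a) all represent the origin, so r_A(0) ≥ |A|.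
  length-A≤rep-origin : length A ≤ rep A origin
  length-A≤rep-origin = subst (_≤ rep A origin) (length-map diagonal A)
    (rep-lower-bound A origin (map diagonal A) (Unique.map⁺ (cong proj₁) unique-A) on-diagonal)
    where
    diagonal : ZpSq p → ZpSq p × ZpSq p
    diagonal a = a , a
    on-diagonal : ∀ {a₁ a₂} → (a₁ , a₂) ∈ map diagonal A → a₁ ∈ A × a₂ ∈ A × subG a₁ a₂ ≡ origin
    on-diagonal a∈W with ∈-map⁻ diagonal a∈W
    ... | (a₁ , a₂) , a∈A , refl = a∈A , a∈A , cong₂ _,_ (subF-unique a₁ a₁ 0F ≈-refl) (subF-unique a₂ a₂ 0F ≈-refl)

  rep-bound : ∀ x → (k ∸ 1) * (k ∸ 1 ∸ 1) ≤ rep A x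
  rep-bound x with x ≟G origin
  ... | yes refl = begin
    (k ∸ 1) * (k ∸ 1 ∸ 1)  ≤⟨ *-mono-≤ (m∸n≤m k 1) (≤-trans (m∸n≤m (k ∸ 1) 1) (≤-trans (m∸n≤m k 1) (s≤s⁻¹ k<p))) ⟩
    k * q                  ≤⟨ m≤m+n (k * q) 1 ⟩
    k * q + 1              ≡⟨ length-A ⟨
    length A               ≤⟨ length-A≤rep-origin ⟩
    rep A origin           ∎
    where open ≤-Reasoning
  ... | no x≢0 = ≤-trans (*-mono-≤ k-1≤m (∸-monoˡ-≤ 1 k-1≤m)) (Representation.missing-pairs-≤-rep u v)
    where
    u v : Fin p
    u = proj₁ x
    v = proj₂ x
    k-1≤m : k ∸ 1 ≤ length (Representation.missing u v)
    k-1≤m = ∸-monoˡ-≤ 1 (k≤1+missing u v x≢0)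

isqrt-≥ : ∀ n j → j ≤ n → j * j ≤ n → j ≤ isqrt n
isqrt-≥ n = search-≥ n
  where
  search-≥ : ∀ m j → j ≤ m → j * j ≤ n → j ≤ isqrtGo n m
  search-≥ zero j j≤0 _ = j≤0
  search-≥ (suc m) j j≤1+m j²≤n with suc m * suc m ≤ᵇ n in test
  ... | true = j≤1+m
  ... | false with m≤n⇒m<n∨m≡n j≤1+m
  ...   | inj₁ j<1+m = search-≥ m j (s≤s⁻¹ j<1+m) j²≤n
  ...   | inj₂ refl = ⊥-elim (subst Bool.T test (≤⇒≤ᵇ j²≤n))

module GrowthBound where
  open ℤ using (+_; _-_; _⊖_)

  -- g(k) = k² − 2k + 2 − ⌊√(4k³)⌋ ≤ (k − 1)(k − 2), since ⌊√(4k³)⌋ ≥ k.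
  gOf-≤ : ∀ k → 1 ≤ k → gOf k ℤ.≤ + ((k ∸ 1) * (k ∸ 1 ∸ 1))
  gOf-≤ 1 _ = ℤ.-≤+
  gOf-≤ k@(suc (suc m)) _ = begin
    (+ (k * k + 2) - + (2 * k)) - + s  ≡⟨ cong (_- + s) k²+2-2k≡N+k ⟩
    + (N + k) - + s                    ≡⟨ ℤP.[+m]-[+n]≡m⊖n (N + k) s ⟩
    (N + k) ⊖ s                        ≤⟨ ℤP.⊖-monoʳ-≥-≤ (N + k) k≤s ⟩
    (N + k) ⊖ k                        ≡⟨ ℤP.⊖-≥ (m≤n+m k N) ⟩
    + (N + k ∸ k)                      ≡⟨ cong +_ (m+n∸n≡m N k) ⟩
    + N                                ∎
    where
    open ℤP.≤-Reasoning
    N s : ℕ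
    N = suc m * m
    s = isqrt (4 * (k * k * k))

    k²+2-2k≡N+k : + (k * k + 2) - + (2 * k) ≡ + (N + k)
    k²+2-2k≡N+k = begin-equality
      + (k * k + 2) - + (2 * k)          ≡⟨ ℤP.[+m]-[+n]≡m⊖n (k * k + 2) (2 * k) ⟩
      (k * k + 2) ⊖ (2 * k)              ≡⟨ cong (_⊖ (2 * k)) (solve 1 (λ m → (con 2 :+ m) :* (con 2 :+ m) :+ con 2
                                               := con 2 :* (con 2 :+ m) :+ ((con 1 :+ m) :* m :+ (con 2 :+ m))) refl m) ⟩
      (2 * k + (N + k)) ⊖ (2 * k)        ≡⟨ ℤP.⊖-≥ (m≤m+n (2 * k) (N + k)) ⟩
      + (2 * k + (N + k) ∸ 2 * k)        ≡⟨ cong +_ (m+n∸m≡n (2 * k) (N + k)) ⟩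
      + (N + k)                          ∎

    k≤s : k ≤ s
    k≤s = isqrt-≥ _ k (≤-trans k≤k³ (m≤n*m _ 4)) (≤-trans (m≤m*n (k * k) k) (m≤n*m _ 4))
      where
      k≤k³ : k ≤ k * k * k
      k≤k³ = ≤-trans (m≤m*n k k) (m≤m*n (k * k) k)

open GrowthBound using (gOf-≤)

mainTheorem2 : (k : ℕ) → 1 ≤ k →
    Σ ℕ (λ P → (p : ℕ) → P ≤ p → (pp : Prime p) →
      Σ (List (ZpSq p)) (λ A →
        Unique A × length A ≡ k * (p ∸ 1) + 1 × IsDiffSet {{prime⇒nonZero pp}} (gOf k) A))
mainTheorem2 k 1≤k = suc k , difference-set
  where
  difference-set : (p : ℕ) → suc k ≤ p → (pp : Prime p) →
    Σ (List (ZpSq p)) (λ A →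
      Unique A × length A ≡ k * (p ∸ 1) + 1 × IsDiffSet {{prime⇒nonZero pp}} (gOf k) A)
  difference-set (suc q) k<p pp =
    A , unique-A , length-A , λ x → ℤP.≤-trans (gOf-≤ k 1≤k) (ℤ.+≤+ (rep-bound x))
    where open Construction q k pp k<p
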